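{- For all integers $m \geq 1$ and $n \geq 0$, the number of spanning trees of the generalized cone $C^mK_n$ of the complete graph $K_n$ is $$t(C^m K_n)=m\,(m+n)^{n-1}.$$
   Context: Graphs are finite and connected, and may have multiple edges and self-loops; $t(G)$ denotes the number of spanning trees of $G$, where parallel edges are distinguished (so two spanning trees using different parallel edges count as different). $K_n$ is the complete graph on $n$ vertices ($K_0$ is the empty graph). For a graph $G$ and an integer $m\geq 1$, the generalized cone $C^mG$ is obtained from $G$ by adding one new vertex $p$ and joining $p$ to each vertex of $G$ by exactly $m$ parallel edges. In particular $C^mK_0$ is a single vertex, and $t$ of it is $1$. -}

module Defs where

open import Data.Nat using (ℕ; zero; suc; _+_; _*_; _^_; _≤_)
open import Data.Fin using (Fin; zero; suc)
open import Data.List using (List; []; _∷_; map; _++_; length; replicate; concatMap; lookup; allFin)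
open import Data.List.Relation.Unary.Unique.Propositional using (Unique)
open import Data.List.Membership.Propositional using () renaming (_∈_ to _∈ₗ_)
open import Data.Fin.Subset using (Subset; _∈_)
open import Data.Product using (Σ; _×_; _,_; ∃; proj₁; proj₂)
open import Data.Product using () renaming (map to pmap)
open import Data.Sum using (_⊎_)
open import Data.Empty using (⊥)
open import Relation.Nullary using (¬_)
open import Relation.Binary.PropositionalEquality using (_≡_)
open import Function.Bundles using (_⇔_)

-- A finite multigraph: vertices Fin V, edges Fin E, each edge with its two
-- endpoints.  Parallel edges and self-loops are allowed; edges are
-- distinguished by their index.
record Graph : Set where
  constructor graph
  field
    V    : ℕ
    E    : ℕ
    ends : Fin E → Fin V × Fin V
open Graph public

fromList : (v : ℕ) → List (Fin v × Fin v) → Graph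
fromList v es = graph v (length es) (lookup es)

Step : {V : ℕ} → Fin V × Fin V → Fin V → Fin V → Set
Step (a , b) u w = (a ≡ u × b ≡ w) ⊎ (a ≡ w × b ≡ u)

data Walk (G : Graph) (S : Subset (E G)) : Fin (V G) → Fin (V G) → List (Fin (E G)) → Set where
  nil  : ∀ u → Walk G S u u []
  cons : ∀ {u w x es} (i : Fin (E G)) → i ∈ S → Step (ends G i) u w →
         Walk G S w x es → Walk G S u x (i ∷ es)

Connected : (G : Graph) → Subset (E G) → Set
Connected G S = ∀ u w → ∃ λ es → Walk G S u w es

-- The spanning subgraph (V G, S) contains a cycle: a closed walk of
-- positive length with pairwise distinct edges (closed trail).
HasCycle : (G : Graph) → Subset (E G) → Set
HasCycle G S = Σ (Fin (V G)) λ u → Σ (Fin (E G)) λ i → Σ (List (Fin (E G))) λ es →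
  Unique (i ∷ es) × Walk G S u u (i ∷ es)

IsSpanningTree : (G : Graph) → Subset (E G) → Set
IsSpanningTree G S = Connected G S × ¬ HasCycle G S

SpanningTreeCount : Graph → ℕ → Set
SpanningTreeCount G N = Σ (List (Subset (E G))) λ L →
  Unique L × (∀ S → (S ∈ₗ L) ⇔ IsSpanningTree G S) × length L ≡ N

-- Edge list of the complete graph K_n: one edge {i , j} for each i < j.
KEdges : (n : ℕ) → List (Fin n × Fin n)
KEdges zero    = []
KEdges (suc n) = map (λ j → (zero , suc j)) (allFin n) ++ map (pmap suc suc) (KEdges n)

K : ℕ → Graph
K n = fromList n (KEdges n)

-- Generalized cone C^m G for G given by an edge list on Fin n:
-- new vertex p = zero, old vertex i becomes suc i, and p is joined to
-- each old vertex by exactly m parallel edges.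
ConeEdges : (m n : ℕ) → List (Fin n × Fin n) → List (Fin (suc n) × Fin (suc n))
ConeEdges m n es = map (pmap suc suc) es ++ concatMap (λ i → replicate m (zero , suc i)) (allFin n)

ConeK : (m n : ℕ) → Graph
ConeK m n = fromList (suc n) (ConeEdges m n (KEdges n))

-- Root every spanning tree of C^m K_n at the cone vertex p. A spanning tree is then the
-- same as a choice, for every other vertex, of an edge to its parent such that following
-- parents always leads to p. Count such choices in a graph where each non-root vertex has
-- s edges to the root and w y edges to every other vertex y: the answer is s (s + Σ w)^(k-1)
-- for k non-root vertices. Indeed, contract the first non-root vertex into its parent. If
-- the parent is the root (s ways), the root gains weight w 1; if it is another vertex y
-- (w y ways), y absorbs the weight w 1. Either way the contracted graph has the same shape
-- with Σ w unchanged, so induction applies. For C^m K_n, s = m and w y = 1.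

module Submission where

open import Defs
open import Data.Nat using (ℕ; _+_; _*_; _^_; _≤_)
open import Data.Product using (Σ; _×_)
open import Relation.Binary.PropositionalEquality using (_≡_)

open import Data.Bool using (true; false; if_then_else_)
open import Data.Empty using (⊥-elim)
open import Data.Fin using (Fin; zero; suc; pinch; punchIn)
open import Data.Fin.Patterns using (0F; 1F)
open import Data.Fin.Properties using (_≟_; suc-injective; any?)
open import Data.Fin.Subset using (Subset; _∈_; _⊆_; ⁅_⁆; _∪_) renaming (⊥ to ∅)
open import Data.Fin.Subset.Properties using (_∈?_; ⊆-antisym; x∈p∪q⁺; x∈p∪q⁻; x∈⁅x⁆; x∈⁅y⁆⇒x≡y; ∉⊥)
open import Data.List as List
  using (List; []; _∷_; map; _++_; length; filter; cartesianProductWith; allFin; concatMap; replicate)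
open import Data.List.Membership.Propositional using () renaming (_∈_ to _∈ₗ_; _∉_ to _∉ₗ_)
open import Data.List.Membership.Propositional.Properties
  using (∈-cartesianProductWith⁺; ∈-cartesianProductWith⁻; ∈-filter⁺; ∈-filter⁻; ∈-map⁺; ∈-map⁻; ∈-allFin)
open import Data.List.Properties
  using (length-++; length-map; map-++; map-cong; map-∘; filter-++; filter-none; map-tabulate; tabulate-lookup)
open import Data.List.Relation.Unary.All as All using (All; []; _∷_)
open import Data.List.Relation.Unary.All.Properties using (replicate⁺; map⁺; ¬Any⇒All¬; All¬⇒¬Any)
open import Data.List.Relation.Unary.AllPairs using ([]; _∷_)
open import Data.List.Relation.Unary.Any using (here; there) renaming (any? to anyₗ?)
open import Data.List.Relation.Unary.Unique.Propositional using (Unique)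
import Data.List.Relation.Unary.Unique.Propositional.Properties as Unique
open import Data.Nat using (zero; suc; _<_; z≤n; s≤s; s≤s⁻¹)
open import Data.Nat.Induction using (<-rec)
open import Data.Nat.ListAction using (sum)
open import Data.Nat.Properties
  using ( ≤-refl; ≤-trans; <-irrefl; <-asym; <⇒≤; <⇒≱; ≮⇒≥; ≤-<-trans; <-≤-trans; n<1+n; n≮0
        ; +-assoc; +-comm; +-identityʳ; *-identityʳ; *-zeroʳ; *-suc; *-assoc; *-comm
        ; *-distribˡ-+; *-distribʳ-+; +-monoˡ-≤; *-monoʳ-≤; anyUpTo?; +-*-semiring; module ≤-Reasoning)
open import Algebra.Properties.Semiring.Sum +-*-semiring
  using (sum-syntax; sum-replicate-zero; sum-cong-≗; ∑-distrib-+; *-distribʳ-sum) renaming (sum to ∑)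
open import Data.Nat.Solver using (module +-*-Solver)
open import Data.Product using (_,_; proj₁; proj₂; ∃; ∃₂) renaming (map to pmap)
import Data.Product as Product
open import Data.Sum using (_⊎_; inj₁; inj₂)
import Data.Sum as Sum
open import Data.Vec using (Vec; []; _∷_; lookup; tabulate)
open import Data.Vec.Properties using (∷-injective; lookup∘tabulate; tabulate∘lookup; tabulate-cong)
open import Function using (_∘_; id; _⇔_; mk⇔; Equivalence)
open import Function.Properties.Equivalence using () renaming (sym to ⇔-sym)
open import Relation.Binary.PropositionalEquality using (_≢_; refl; sym; trans; cong; cong₂; subst; module ≡-Reasoning)
open import Relation.Nullary using (¬_; Dec; yes; no; does)
import Relation.Nullary.Decidable as Dec
open import Relation.Nullary.Decidable using (_×-dec_; _⊎-dec_)
open import Relation.Unary using (Decidable)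

private
  variable
    A B C D A′ B′ : Set

choices : ∀ {n} → (Fin n → List A) → List (Vec A n)
choices {n = zero}  f = [] ∷ []
choices {n = suc n} f = cartesianProductWith _∷_ (f zero) (choices (f ∘ suc))

∈-choices⁺ : ∀ {n} (f : Fin n → List A) {v} → (∀ x → lookup v x ∈ₗ f x) → v ∈ₗ choices f
∈-choices⁺ {n = zero}  f {[]}    _ = here refl
∈-choices⁺ {n = suc n} f {a ∷ v} h = ∈-cartesianProductWith⁺ _∷_ (h zero) (∈-choices⁺ (f ∘ suc) (h ∘ suc))

∈-choices⁻ : ∀ {n} (f : Fin n → List A) {v} → v ∈ₗ choices f → ∀ x → lookup v x ∈ₗ f x
∈-choices⁻ {n = suc n} f v∈ x with ∈-cartesianProductWith⁻ _∷_ (f zero) (choices (f ∘ suc)) v∈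
∈-choices⁻ {n = suc n} f v∈ zero    | a , w , a∈ , w∈ , refl = a∈
∈-choices⁻ {n = suc n} f v∈ (suc x) | a , w , a∈ , w∈ , refl = ∈-choices⁻ (f ∘ suc) w∈ x

choices-unique : ∀ {n} (f : Fin n → List A) → (∀ x → Unique (f x)) → Unique (choices f)
choices-unique {n = zero}  f _ = [] ∷ []
choices-unique {n = suc n} f u =
  Unique.cartesianProductWith⁺ _∷_ ∷-injective (u zero) (choices-unique (f ∘ suc) (u ∘ suc))

imap : ∀ {n} → (Fin n → A → B) → Vec A n → Vec B n
imap f v = tabulate (λ x → f x (lookup v x))

map-cartesianProductWith : (f : A → B → C) (k : A′ → B′ → D) (h : C → D) (g : A → A′) (g′ : B → B′) →
  (∀ a b → h (f a b) ≡ k (g a) (g′ b)) → ∀ xs ys →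
  map h (cartesianProductWith f xs ys) ≡ cartesianProductWith k (map g xs) (map g′ ys)
map-cartesianProductWith f k h g g′ hf []       ys = refl
map-cartesianProductWith f k h g g′ hf (x ∷ xs) ys = begin
  map h (map (f x) ys ++ cartesianProductWith f xs ys)
    ≡⟨ map-++ h (map (f x) ys) _ ⟩
  map h (map (f x) ys) ++ map h (cartesianProductWith f xs ys)
    ≡⟨ cong₂ _++_ (trans (sym (map-∘ ys)) (trans (map-cong (hf x) ys) (map-∘ ys)))
                  (map-cartesianProductWith f k h g g′ hf xs ys) ⟩
  map (k (g x)) (map g′ ys) ++ cartesianProductWith k (map g xs) (map g′ ys) ∎
  where open ≡-Reasoning

map-choices : ∀ {n} (f : Fin n → A → B) (g : Fin n → List A) →
  map (imap f) (choices g) ≡ choices (λ x → map (f x) (g x))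
map-choices {n = zero}  f g = refl
map-choices {n = suc n} f g = begin
  map (imap f) (cartesianProductWith _∷_ (g zero) (choices (g ∘ suc)))
    ≡⟨ map-cartesianProductWith _∷_ _∷_ (imap f) (f zero) (imap (f ∘ suc)) (λ _ _ → refl) (g zero) _ ⟩
  cartesianProductWith _∷_ (map (f zero) (g zero)) (map (imap (f ∘ suc)) (choices (g ∘ suc)))
    ≡⟨ cong (cartesianProductWith _∷_ (map (f zero) (g zero))) (map-choices (f ∘ suc) (g ∘ suc)) ⟩
  choices (λ x → map (f x) (g x)) ∎
  where open ≡-Reasoning

filter-≐ : {P Q : A → Set} (P? : Decidable P) (Q? : Decidable Q) → (∀ x → P x ⇔ Q x) →
  ∀ xs → filter P? xs ≡ filter Q? xs
filter-≐ P? Q? P⇔Q []       = refl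
filter-≐ P? Q? P⇔Q (x ∷ xs) with P? x | Q? x
... | yes _  | yes _  = cong (x ∷_) (filter-≐ P? Q? P⇔Q xs)
... | no _   | no _   = filter-≐ P? Q? P⇔Q xs
... | yes px | no ¬qx = ⊥-elim (¬qx (Equivalence.to (P⇔Q x) px))
... | no ¬px | yes qx = ⊥-elim (¬px (Equivalence.from (P⇔Q x) qx))

filter-map : {P : B → Set} (P? : Decidable P) (f : A → B) → ∀ xs →
  filter P? (map f xs) ≡ map f (filter (P? ∘ f) xs)
filter-map P? f []       = refl
filter-map P? f (x ∷ xs) with does (P? (f x))
... | true  = cong (f x ∷_) (filter-map P? f xs)
... | false = filter-map P? f xs

count : {P : A → Set} → Decidable P → List A → ℕ
count P? xs = length (filter P? xs)

module _ {P : A → Set} (P? : Decidable P) where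

  count-++ : ∀ xs ys → count P? (xs ++ ys) ≡ count P? xs + count P? ys
  count-++ xs ys = trans (cong length (filter-++ P? xs ys)) (length-++ (filter P? xs))

  count-map : (f : B → A) → ∀ xs → count P? (map f xs) ≡ count (P? ∘ f) xs
  count-map f xs = trans (cong length (filter-map P? f xs)) (length-map f (filter (P? ∘ f) xs))

  count-none : ∀ {xs} → All (¬_ ∘ P) xs → count P? xs ≡ 0
  count-none ¬P = cong length (filter-none P? ¬P)

  count-≐ : {Q : A → Set} (Q? : Decidable Q) → (∀ x → P x ⇔ Q x) → ∀ xs → count P? xs ≡ count Q? xs
  count-≐ Q? P⇔Q xs = cong length (filter-≐ P? Q? P⇔Q xs)

  count-filter : {Q : A → Set} (Q? : Decidable Q) → ∀ xs →
    count Q? (filter P? xs) ≡ count (λ x → P? x ×-dec Q? x) xs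
  count-filter Q? []       = refl
  count-filter Q? (x ∷ xs) with P? x
  ... | no _  = count-filter Q? xs
  ... | yes _ with Q? x
  ...   | yes _ = cong suc (count-filter Q? xs)
  ...   | no _  = count-filter Q? xs

  count-cartesianProductWith : (f : B → C → A) → ∀ xs ys →
    count P? (cartesianProductWith f xs ys) ≡ sum (map (λ x → count P? (map (f x) ys)) xs)
  count-cartesianProductWith f []       ys = refl
  count-cartesianProductWith f (x ∷ xs) ys =
    trans (count-++ (map (f x) ys) _) (cong (count P? (map (f x) ys) +_) (count-cartesianProductWith f xs ys))

  count-replicate : ∀ k {a} → P a → count P? (replicate k a) ≡ k
  count-replicate zero        pa = refl
  count-replicate (suc k) {a} pa with P? a
  ... | yes _  = cong suc (count-replicate k pa)
  ... | no ¬pa = ⊥-elim (¬pa pa)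

  count-concatMap-replicate : ∀ m (g : B → A) xs →
    count P? (concatMap (λ x → replicate m (g x)) xs) ≡ m * count (P? ∘ g) xs
  count-concatMap-replicate m g []       = sym (*-zeroʳ m)
  count-concatMap-replicate m g (x ∷ xs) with P? (g x)
  ... | yes pgx = begin
    count P? (replicate m (g x) ++ rest)          ≡⟨ count-++ (replicate m (g x)) rest ⟩
    count P? (replicate m (g x)) + count P? rest  ≡⟨ cong₂ _+_ (count-replicate m pgx) (count-concatMap-replicate m g xs) ⟩
    m + m * count (P? ∘ g) xs                     ≡⟨ sym (*-suc m _) ⟩
    m * suc (count (P? ∘ g) xs)                   ∎
    where open ≡-Reasoning
          rest = concatMap (λ x → replicate m (g x)) xs
  ... | no ¬pgx = begin
    count P? (replicate m (g x) ++ rest)          ≡⟨ count-++ (replicate m (g x)) rest ⟩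
    count P? (replicate m (g x)) + count P? rest
      ≡⟨ cong₂ _+_ (count-none (replicate⁺ m ¬pgx)) (count-concatMap-replicate m g xs) ⟩
    m * count (P? ∘ g) xs                         ∎
    where open ≡-Reasoning
          rest = concatMap (λ x → replicate m (g x)) xs

Unique-map⁺ : (f : A → B) {xs : List A} → (∀ {a b} → a ∈ₗ xs → b ∈ₗ xs → f a ≡ f b → a ≡ b) →
  Unique xs → Unique (map f xs)
Unique-map⁺ f inj []       = []
Unique-map⁺ f inj (x∉ ∷ u) =
  map⁺ (All.tabulate (λ y∈ fx≡fy → All.lookup x∉ y∈ (inj (here refl) (there y∈) fx≡fy))) ∷
  Unique-map⁺ f (λ a∈ b∈ → inj (there a∈) (there b∈)) u

module _ {P : ℕ → Set} (P? : Decidable P) where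

  private
    Least : Set
    Least = Σ ℕ λ m → P m × (∀ {j} → P j → m ≤ j)

  leastWitness : ∀ {k} → P k → Least
  leastWitness {k} = <-rec (λ k → P k → Least) search k
    where
    search : ∀ k → (∀ {j} → j < k → P j → Least) → P k → Least
    search k below pk with anyUpTo? P? k
    ... | yes (j , j<k , pj) = below j<k pj
    ... | no none            = k , pk , λ pj → ≮⇒≥ (λ j<k → none (_ , j<k , pj))

δ : ∀ {k} → Fin k → Fin k → ℕ
δ a b = if does (a ≟ b) then 1 else 0

δ≤1 : ∀ {k} (a b : Fin k) → δ a b ≤ 1
δ≤1 a b with does (a ≟ b)
... | true  = ≤-refl
... | false = z≤n

mult : ∀ {k} → List (Fin k) → Fin k → ℕ
mult l b = count (_≟ b) l

mult-∷ : ∀ {k} (a : Fin k) l b → mult (a ∷ l) b ≡ δ a b + mult l b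
mult-∷ a l b with does (a ≟ b)
... | true  = refl
... | false = refl

mult-allFin : ∀ {n} (y : Fin n) → mult (allFin n) y ≡ 1
mult-allFin {suc n} y = begin
  mult (0F ∷ List.tabulate suc) y             ≡⟨ mult-∷ 0F (List.tabulate suc) y ⟩
  δ 0F y + count (_≟ y) (List.tabulate suc)   ≡⟨ cong (λ l → δ 0F y + count (_≟ y) l) (sym (map-tabulate id suc)) ⟩
  δ 0F y + count (_≟ y) (map suc (allFin n))  ≡⟨ cong (δ 0F y +_) (count-map (_≟ y) suc (allFin n)) ⟩
  δ 0F y + count ((_≟ y) ∘ suc) (allFin n)    ≡⟨ shifted y ⟩
  1                                            ∎
  where
  open ≡-Reasoning
  shifted : ∀ y → δ 0F y + count ((_≟ y) ∘ suc) (allFin n) ≡ 1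
  shifted 0F      = cong suc (count-none ((_≟ 0F) ∘ suc) (All.universal (λ _ ()) (allFin n)))
  shifted (suc y) = trans (count-≐ ((_≟ suc y) ∘ suc) (_≟ y) (λ _ → mk⇔ suc-injective (cong suc)) (allFin n))
                          (mult-allFin y)

count-allFin : ∀ {n} {P : Fin n → Set} (P? : Decidable P) y → (∀ j → P j ⇔ j ≡ y) → count P? (allFin n) ≡ 1
count-allFin P? y P⇔ = trans (count-≐ P? (_≟ y) P⇔ (allFin _)) (mult-allFin y)

∑-δ : ∀ {k} (a : Fin k) (h : Fin k → ℕ) → ∑[ v < k ] (δ a v * h v) ≡ h a
∑-δ {suc k} zero    h = trans (cong (h zero + 0 +_) (sum-replicate-zero k)) (trans (+-identityʳ _) (+-identityʳ _))
∑-δ {suc k} (suc a) h = ∑-δ a (h ∘ suc)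

sum-map-by-mult : ∀ {k} (h : Fin k → ℕ) l → sum (map h l) ≡ ∑[ v < k ] (mult l v * h v)
sum-map-by-mult {k} h []      = sym (sum-replicate-zero k)
sum-map-by-mult {k} h (a ∷ l) = begin
  h a + sum (map h l)
    ≡⟨ cong₂ _+_ (sym (∑-δ a h)) (sum-map-by-mult h l) ⟩
  ∑[ v < k ] (δ a v * h v) + ∑[ v < k ] (mult l v * h v)
    ≡⟨ sym (∑-distrib-+ (λ v → δ a v * h v) (λ v → mult l v * h v)) ⟩
  ∑[ v < k ] (δ a v * h v + mult l v * h v)
    ≡⟨ sum-cong-≗ (λ v → trans (sym (*-distribʳ-+ (h v) (δ a v) (mult l v))) (cong (_* h v) (sym (mult-∷ a l v)))) ⟩
  ∑[ v < k ] (mult (a ∷ l) v * h v) ∎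
  where open ≡-Reasoning

∑-ones : ∀ n → ∑[ i < n ] 1 ≡ n
∑-ones zero    = refl
∑-ones (suc n) = cong suc (∑-ones n)

-- Rooted parent maps and the weighted Cayley formula

-- Vertex suc x has parent lookup t x and 0F is the root. A height that strictly decreases
-- along parents certifies that every chain of parents reaches 0F.
Rooted : ∀ {n} → Vec (Fin (suc n)) n → Set
Rooted {n} t = Σ (Fin (suc n) → ℕ) λ height → ∀ x → height (lookup t x) < height (suc x)

rooted-[] : Rooted []
rooted-[] = (λ _ → 0) , λ ()

-- Contracting the edge between vertex 1F and its parent a: 1F is merged into a and the
-- other vertices are renumbered in order (the value at a = 1F is junk and never used).
contract : ∀ {n} → Fin (suc (suc n)) → Fin (suc (suc n)) → Fin (suc n)
contract a 1F = pinch 0F a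
contract a e  = pinch 0F e

contracted : ∀ {n} → Fin (suc (suc n)) → Vec (Fin (suc (suc n))) n → Vec (Fin (suc n)) n
contracted a = imap (λ _ → contract a)

lookup-contracted : ∀ {n} a (v : Vec (Fin (suc (suc n))) n) k → lookup (contracted a v) k ≡ contract a (lookup v k)
lookup-contracted a v = lookup∘tabulate (λ k → contract a (lookup v k))

punchIn-pinch : ∀ {n} {a : Fin (suc (suc n))} → a ≢ 1F → punchIn 1F (pinch 0F a) ≡ a
punchIn-pinch {a = 0F}          _   = refl
punchIn-pinch {a = 1F}          a≢1 = ⊥-elim (a≢1 refl)
punchIn-pinch {a = suc (suc _)} _   = refl

¬Rooted-loop : ∀ {n} {v : Vec (Fin (suc (suc n))) n} → ¬ Rooted (1F ∷ v)
¬Rooted-loop (height , down) = <-irrefl refl (down 0F)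

Rooted⇒Rooted-contracted : ∀ {n} {a} {v : Vec (Fin (suc (suc n))) n} → a ≢ 1F →
  Rooted (a ∷ v) → Rooted (contracted a v)
Rooted⇒Rooted-contracted {a = a} {v} a≢1 (height , down) = height ∘ punchIn 1F , down′
  where
  shortcut : ∀ e → height (punchIn 1F (contract a e)) ≤ height e
  shortcut 0F            = ≤-refl
  shortcut 1F            = subst (λ c → height c ≤ height 1F) (sym (punchIn-pinch a≢1)) (<⇒≤ (down 0F))
  shortcut (suc (suc _)) = ≤-refl
  down′ : ∀ k → height (punchIn 1F (lookup (contracted a v) k)) < height (suc (suc k))
  down′ k = subst (λ c → height (punchIn 1F c) < height (suc (suc k))) (sym (lookup-contracted a v k))
                  (≤-<-trans (shortcut (lookup v k)) (down (suc k)))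

d≤1∧p<q⇒d+2*p<2*q : ∀ {d p q} → d ≤ 1 → p < q → d + 2 * p < 2 * q
d≤1∧p<q⇒d+2*p<2*q {d} {p} {q} d≤1 p<q = begin-strict
  d + 2 * p  ≤⟨ +-monoˡ-≤ (2 * p) d≤1 ⟩
  1 + 2 * p  <⟨ n<1+n _ ⟩
  2 + 2 * p  ≡⟨ sym (*-distribˡ-+ 2 1 p) ⟩
  2 * suc p  ≤⟨ *-monoʳ-≤ 2 p<q ⟩
  2 * q      ∎
  where open ≤-Reasoning

contract-parent-of-1 : ∀ {n} (a : Fin (suc (suc n))) → a ≢ 1F → (height : Fin (suc n) → ℕ) →
  δ a 1F + 2 * height (contract a a) < 1 + 2 * height (contract a 1F)
contract-parent-of-1 0F            _   height = n<1+n _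
contract-parent-of-1 1F            a≢1 height = ⊥-elim (a≢1 refl)
contract-parent-of-1 (suc (suc _)) _   height = n<1+n _

-- Doubling the contracted height leaves room to put vertex 1F just above its parent.
Rooted-contracted⇒Rooted : ∀ {n} {a} {v : Vec (Fin (suc (suc n))) n} → a ≢ 1F →
  Rooted (contracted a v) → Rooted (a ∷ v)
Rooted-contracted⇒Rooted {a = a} {v} a≢1 (height , down) = height′ , down′
  where
  height′ : Fin _ → ℕ
  height′ e = δ e 1F + 2 * height (contract a e)
  down′ : ∀ x → height′ (lookup (a ∷ v) x) < height′ (suc x)
  down′ 0F      = contract-parent-of-1 a a≢1 height
  down′ (suc k) = d≤1∧p<q⇒d+2*p<2*q (δ≤1 (lookup v k) 1F)
    (subst (λ c → height c < height (suc k)) (lookup-contracted a v k) (down k))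

Rooted⇔Rooted-contracted : ∀ {n} {a} {v : Vec (Fin (suc (suc n))) n} → a ≢ 1F →
  Rooted (a ∷ v) ⇔ Rooted (contracted a v)
Rooted⇔Rooted-contracted a≢1 = mk⇔ (Rooted⇒Rooted-contracted a≢1) (Rooted-contracted⇒Rooted a≢1)

rooted? : ∀ {n} → Decidable (Rooted {n})
rooted? {zero}  []      = yes rooted-[]
rooted? {suc n} (a ∷ v) with a ≟ 1F
... | yes refl = no ¬Rooted-loop
... | no a≢1   = Dec.map (⇔-sym (Rooted⇔Rooted-contracted a≢1)) (rooted? (contracted a v))

-- The possible parents of each non-root vertex, with multiplicity: one entry per edge.
Candidates : ℕ → Set
Candidates n = Fin n → List (Fin (suc n))

rootedCount : ∀ {n} → Candidates n → ℕ
rootedCount candidates = count rooted? (choices candidates)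

contractedCandidates : ∀ {n} → Fin (suc (suc n)) → Candidates (suc n) → Candidates n
contractedCandidates a candidates x = map (contract a) (candidates (suc x))

branchCount : ∀ {n} → Candidates (suc n) → Fin (suc (suc n)) → ℕ
branchCount candidates 1F = 0
branchCount candidates a  = rootedCount (contractedCandidates a candidates)

rootedCount-branches : ∀ {n} (candidates : Candidates (suc n)) →
  rootedCount candidates ≡ sum (map (branchCount candidates) (candidates 0F))
rootedCount-branches candidates =
  trans (count-cartesianProductWith rooted? _∷_ (candidates 0F) rest) (cong sum (map-cong branch (candidates 0F)))
  where
  rest = choices (candidates ∘ suc)
  branch-≢1 : ∀ {a} → a ≢ 1F → count rooted? (map (a ∷_) rest) ≡ rootedCount (contractedCandidates a candidates)
  branch-≢1 {a} a≢1 = begin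
    count rooted? (map (a ∷_) rest)
      ≡⟨ count-map rooted? (a ∷_) rest ⟩
    count (rooted? ∘ (a ∷_)) rest
      ≡⟨ count-≐ (rooted? ∘ (a ∷_)) (rooted? ∘ contracted a) (λ _ → Rooted⇔Rooted-contracted a≢1) rest ⟩
    count (rooted? ∘ contracted a) rest
      ≡⟨ sym (count-map rooted? (contracted a) rest) ⟩
    count rooted? (map (contracted a) rest)
      ≡⟨ cong (count rooted?) (map-choices (λ _ → contract a) (candidates ∘ suc)) ⟩
    rootedCount (contractedCandidates a candidates) ∎
    where open ≡-Reasoning
  branch : ∀ a → count rooted? (map (a ∷_) rest) ≡ branchCount candidates a
  branch 0F            = branch-≢1 (λ ())
  branch 1F            = trans (count-map rooted? (1F ∷_) rest)
                               (count-none (rooted? ∘ (1F ∷_)) (All.universal (λ _ → ¬Rooted-loop) rest))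
  branch (suc (suc _)) = branch-≢1 (λ ())

δ-contract : ∀ {n} (a e : Fin (suc (suc n))) b →
  δ (contract a e) b ≡ δ e (punchIn 1F b) + δ (pinch 0F a) b * δ e 1F
δ-contract a 0F            0F      = sym (cong suc (*-zeroʳ (δ (pinch 0F a) 0F)))
δ-contract a 0F            (suc b) = sym (*-zeroʳ (δ (pinch 0F a) (suc b)))
δ-contract a 1F            0F      = sym (*-identityʳ (δ (pinch 0F a) 0F))
δ-contract a 1F            (suc b) = sym (*-identityʳ (δ (pinch 0F a) (suc b)))
δ-contract a (suc (suc e)) 0F      = sym (*-zeroʳ (δ (pinch 0F a) 0F))
δ-contract a (suc (suc e)) (suc b) =
  sym (trans (cong (δ e b +_) (*-zeroʳ (δ (pinch 0F a) (suc b)))) (+-identityʳ (δ e b)))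

mult-contract : ∀ {n} (a : Fin (suc (suc n))) l b →
  mult (map (contract a) l) b ≡ mult l (punchIn 1F b) + δ (pinch 0F a) b * mult l 1F
mult-contract a []      b = sym (*-zeroʳ (δ (pinch 0F a) b))
mult-contract a (e ∷ l) b = begin
  mult (contract a e ∷ map (contract a) l) b
    ≡⟨ mult-∷ (contract a e) _ b ⟩
  δ (contract a e) b + mult (map (contract a) l) b
    ≡⟨ cong₂ _+_ (δ-contract a e b) (mult-contract a l b) ⟩
  (δ e b′ + c * δ e 1F) + (mult l b′ + c * mult l 1F)
    ≡⟨ solve 5 (λ d₁ d₂ c m₁ m₂ → (d₁ :+ c :* d₂) :+ (m₁ :+ c :* m₂) := (d₁ :+ m₁) :+ c :* (d₂ :+ m₂))
             refl (δ e b′) (δ e 1F) c (mult l b′) (mult l 1F) ⟩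
  (δ e b′ + mult l b′) + c * (δ e 1F + mult l 1F)
    ≡⟨ sym (cong₂ (λ m₁ m₂ → m₁ + c * m₂) (mult-∷ e l b′) (mult-∷ e l 1F)) ⟩
  mult (e ∷ l) b′ + c * mult (e ∷ l) 1F ∎
  where
  open ≡-Reasoning
  open +-*-Solver
  b′ = punchIn 1F b
  c  = δ (pinch 0F a) b

-- The number of edges from x to y depends on y only: this shape is preserved by contraction.
record Weighted {n} (s : ℕ) (w : Fin n → ℕ) (candidates : Candidates n) : Set where
  field
    root-weight  : ∀ x → mult (candidates x) 0F ≡ s
    other-weight : ∀ x y → y ≢ x → mult (candidates x) (suc y) ≡ w y

module _ {n} {s} {w : Fin (suc n) → ℕ} {candidates : Candidates (suc n)} (weighted : Weighted s w candidates) where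

  open Weighted weighted

  private
    weight-1 : ∀ x → mult (candidates (suc x)) 1F ≡ w 0F
    weight-1 x = other-weight (suc x) 0F (λ ())

    weight-inner : ∀ x y → y ≢ x → mult (candidates (suc x)) (suc (suc y)) ≡ w (suc y)
    weight-inner x y y≢x = other-weight (suc x) (suc y) (y≢x ∘ suc-injective)

  Weighted-contract-root : Weighted (s + w 0F) (w ∘ suc) (contractedCandidates 0F candidates)
  Weighted-contract-root = record
    { root-weight  = λ x → trans (mult-contract 0F (candidates (suc x)) 0F)
                                 (cong₂ _+_ (root-weight (suc x)) (trans (+-identityʳ _) (weight-1 x)))
    ; other-weight = λ x y y≢x → trans (mult-contract 0F (candidates (suc x)) (suc y))
                                       (trans (+-identityʳ _) (weight-inner x y y≢x))
    }

  Weighted-contract-inner : ∀ z → Weighted s (λ y → w (suc y) + δ z y * w 0F)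
                                             (contractedCandidates (suc (suc z)) candidates)
  Weighted-contract-inner z = record
    { root-weight  = λ x → trans (mult-contract (suc (suc z)) (candidates (suc x)) 0F)
                                 (trans (+-identityʳ _) (root-weight (suc x)))
    ; other-weight = λ x y y≢x → trans (mult-contract (suc (suc z)) (candidates (suc x)) (suc y))
                                       (cong₂ (λ p q → p + δ z y * q) (weight-inner x y y≢x) (weight-1 x))
    }

  rootedCount-by-parent-of-1 :
    rootedCount candidates ≡ s * branchCount candidates 0F + ∑[ y < n ] (w (suc y) * branchCount candidates (suc (suc y)))
  rootedCount-by-parent-of-1 = begin
    rootedCount candidates
      ≡⟨ rootedCount-branches candidates ⟩
    sum (map (branchCount candidates) (candidates 0F))
      ≡⟨ sum-map-by-mult (branchCount candidates) (candidates 0F) ⟩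
    mult (candidates 0F) 0F * branchCount candidates 0F
      + (mult (candidates 0F) 1F * 0 + ∑[ y < n ] (mult (candidates 0F) (suc (suc y)) * branchCount candidates (suc (suc y))))
      ≡⟨ cong₂ _+_ (cong (_* branchCount candidates 0F) (root-weight 0F))
                   (cong₂ _+_ (*-zeroʳ (mult (candidates 0F) 1F))
                              (sum-cong-≗ (λ y → cong (_* branchCount candidates (suc (suc y)))
                                                      (other-weight 0F (suc y) (λ ()))))) ⟩
    s * branchCount candidates 0F + ∑[ y < n ] (w (suc y) * branchCount candidates (suc (suc y))) ∎
    where open ≡-Reasoning

rootedCount-weighted : ∀ {n} s (w : Fin (suc n) → ℕ) candidates → Weighted s w candidates →
  rootedCount candidates ≡ s * (s + ∑ w) ^ n
rootedCount-weighted {zero}  s w candidates weighted =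
  trans (rootedCount-by-parent-of-1 weighted) (+-identityʳ (s * 1))
rootedCount-weighted {suc n} s w candidates weighted = begin
  rootedCount candidates
    ≡⟨ rootedCount-by-parent-of-1 weighted ⟩
  s * branchCount candidates 0F + ∑[ y < suc n ] (w (suc y) * branchCount candidates (suc (suc y)))
    ≡⟨ cong₂ _+_ (cong (s *_) root-branch) (sum-cong-≗ (λ y → cong (w (suc y) *_) (inner-branch y))) ⟩
  s * ((s + w 0F) * P) + ∑[ y < suc n ] (w (suc y) * (s * P))
    ≡⟨ cong (s * ((s + w 0F) * P) +_) (sym (*-distribʳ-sum (s * P) (w ∘ suc))) ⟩
  s * ((s + w 0F) * P) + ∑ (w ∘ suc) * (s * P)
    ≡⟨ solve 4 (λ s a b p → s :* ((s :+ a) :* p) :+ b :* (s :* p) := s :* ((s :+ (a :+ b)) :* p))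
             refl s (w 0F) (∑ (w ∘ suc)) P ⟩
  s * (s + ∑ w) ^ suc n ∎
  where
  open ≡-Reasoning
  open +-*-Solver
  P = (s + ∑ w) ^ n
  root-branch : branchCount candidates 0F ≡ (s + w 0F) * P
  root-branch = trans (rootedCount-weighted (s + w 0F) (w ∘ suc) _ (Weighted-contract-root weighted))
                      (cong (λ t → (s + w 0F) * t ^ n) (+-assoc s (w 0F) (∑ (w ∘ suc))))
  merged-weight : ∀ z → ∑[ y < suc n ] (w (suc y) + δ z y * w 0F) ≡ ∑ w
  merged-weight z = begin
    ∑[ y < suc n ] (w (suc y) + δ z y * w 0F)    ≡⟨ ∑-distrib-+ (w ∘ suc) (λ y → δ z y * w 0F) ⟩
    ∑ (w ∘ suc) + ∑[ y < suc n ] (δ z y * w 0F)  ≡⟨ cong (∑ (w ∘ suc) +_) (∑-δ z (λ _ → w 0F)) ⟩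
    ∑ (w ∘ suc) + w 0F                           ≡⟨ +-comm (∑ (w ∘ suc)) (w 0F) ⟩
    ∑ w                                          ∎
  inner-branch : ∀ z → branchCount candidates (suc (suc z)) ≡ s * P
  inner-branch z = trans (rootedCount-weighted s _ _ (Weighted-contract-inner weighted z))
                         (cong (λ t → s * (s + t) ^ n) (merged-weight z))

rootedCount-weighted′ : ∀ {n} s (w : Fin n → ℕ) candidates → Weighted s w candidates →
  rootedCount candidates * (s + ∑ w) ≡ s * (s + ∑ w) ^ n
rootedCount-weighted′ {zero}  s w candidates weighted =
  trans (+-identityʳ (s + 0)) (trans (+-identityʳ s) (sym (*-identityʳ s)))
rootedCount-weighted′ {suc n} s w candidates weighted = begin
  rootedCount candidates * (s + ∑ w)  ≡⟨ cong (_* (s + ∑ w)) (rootedCount-weighted s w candidates weighted) ⟩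
  s * (s + ∑ w) ^ n * (s + ∑ w)       ≡⟨ *-assoc s _ (s + ∑ w) ⟩
  s * ((s + ∑ w) ^ n * (s + ∑ w))     ≡⟨ cong (s *_) (*-comm _ (s + ∑ w)) ⟩
  s * (s + ∑ w) ^ suc n               ∎
  where open ≡-Reasoning

module _ {k : ℕ} where

  Incident : Fin k → Fin k × Fin k → Set
  Incident v (a , b) = a ≡ v ⊎ b ≡ v

  incident? : ∀ v → Decidable (Incident v)
  incident? v (a , b) = (a ≟ v) ⊎-dec (b ≟ v)

  other : Fin k → Fin k × Fin k → Fin k
  other v (a , b) = if does (a ≟ v) then b else a

  Step? : ∀ (u w : Fin k) → Decidable (λ p → Step p u w)
  Step? u w (a , b) = ((a ≟ u) ×-dec (b ≟ w)) ⊎-dec ((a ≟ w) ×-dec (b ≟ u))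

  Step-other : ∀ {v} p → Incident v p → Step p v (other v p)
  Step-other {v} (a , b) incident with a ≟ v | incident
  ... | yes a≡v | _        = inj₁ (a≡v , refl)
  ... | no _    | inj₂ b≡v = inj₂ (refl , b≡v)
  ... | no a≢v  | inj₁ a≡v = ⊥-elim (a≢v a≡v)

  other-Step : ∀ {v w} p → Step p v w → other v p ≡ w
  other-Step {v} (a , b) (inj₁ (a≡v , b≡w)) with a ≟ v
  ... | yes _   = b≡w
  ... | no a≢v  = ⊥-elim (a≢v a≡v)
  other-Step {v} (a , b) (inj₂ (a≡w , b≡v)) with a ≟ v
  ... | yes a≡v = trans (trans b≡v (sym a≡v)) a≡w
  ... | no _    = a≡w

  Step⇒Incident : ∀ {v w} p → Step p v w → Incident v p
  Step⇒Incident p (inj₁ (a≡v , _)) = inj₁ a≡v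
  Step⇒Incident p (inj₂ (_ , b≡v)) = inj₂ b≡v

  Incident×other⇔Step : ∀ {v b} p → (Incident v p × other v p ≡ b) ⇔ Step p v b
  Incident×other⇔Step p = mk⇔ (λ { (incident , refl) → Step-other p incident })
                              (λ st → Step⇒Incident p st , other-Step p st)

  Step-sym : ∀ {p} {u w : Fin k} → Step p u w → Step p w u
  Step-sym (inj₁ e) = inj₂ e
  Step-sym (inj₂ e) = inj₁ e

  Step-unique : ∀ {p} {u v a b : Fin k} → Step p u v → Step p a b → (a ≡ u × b ≡ v) ⊎ (a ≡ v × b ≡ u)
  Step-unique (inj₁ (refl , refl)) (inj₁ (refl , refl)) = inj₁ (refl , refl)
  Step-unique (inj₁ (refl , refl)) (inj₂ (refl , refl)) = inj₂ (refl , refl)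
  Step-unique (inj₂ (refl , refl)) (inj₁ (refl , refl)) = inj₂ (refl , refl)
  Step-unique (inj₂ (refl , refl)) (inj₂ (refl , refl)) = inj₁ (refl , refl)

  Step-flip : ∀ {p} {a b c d : Fin k} → Step p a b → Step p c d → a ≢ c → b ≡ c × d ≡ a
  Step-flip st st′ a≢c with Step-unique st st′
  ... | inj₁ (c≡a , _)   = ⊥-elim (a≢c (sym c≡a))
  ... | inj₂ (c≡b , d≡a) = sym c≡b , d≡a

mult-neighbours : ∀ {I : Set} {k} (en : I → Fin k × Fin k) v b is →
  mult (map (other v ∘ en) (filter (incident? v ∘ en) is)) b ≡ count (Step? v b ∘ en) is
mult-neighbours en v b is = begin
  mult (map (other v ∘ en) (filter (incident? v ∘ en) is)) b
    ≡⟨ count-map (_≟ b) (other v ∘ en) (filter (incident? v ∘ en) is) ⟩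
  count ((_≟ b) ∘ other v ∘ en) (filter (incident? v ∘ en) is)
    ≡⟨ count-filter (incident? v ∘ en) ((_≟ b) ∘ other v ∘ en) is ⟩
  count (λ i → incident? v (en i) ×-dec (other v (en i) ≟ b)) is
    ≡⟨ count-≐ _ (Step? v b ∘ en) (λ i → Incident×other⇔Step (en i)) is ⟩
  count (Step? v b ∘ en) is ∎
  where open ≡-Reasoning

module _ {G : Graph} {S : Subset (E G)} where

  walk-++ : ∀ {u v w es fs} → Walk G S u v es → Walk G S v w fs → Walk G S u w (es ++ fs)
  walk-++ (nil _)           W = W
  walk-++ (cons i i∈ st W₁) W = cons i i∈ st (walk-++ W₁ W)

  walk-reverse : ∀ {u w es} → Walk G S u w es → ∃ λ fs → Walk G S w u fs
  walk-reverse (nil u) = [] , nil u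
  walk-reverse {u} (cons i i∈ st W) with walk-reverse W
  ... | fs , W′ = fs ++ i ∷ [] , walk-++ W′ (cons i i∈ (Step-sym st) (nil u))

  walk-edges : ∀ {u w es} → Walk G S u w es → ∀ {i} → i ∈ₗ es → i ∈ S
  walk-edges (cons i i∈ _ _) (here refl) = i∈
  walk-edges (cons _ _ _ W)  (there i∈)  = walk-edges W i∈

  walk-split : ∀ {v w es i} → Walk G S v w es → Unique es → i ∈ₗ es →
    ∃₂ λ p q → ∃ λ fs → Step (ends G i) p q × Walk G S q w fs × Unique (i ∷ fs)
  walk-split (cons _ _ st W) u       (here refl) = _ , _ , _ , st , W , u
  walk-split (cons _ _ _ W)  (_ ∷ u) (there i∈)  = walk-split W u i∈

  -- If the first edge recurs later, restart from its later traversal in the right direction.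
  walk⇒trail : ∀ {u w es} → Walk G S u w es → ∃ λ fs → Walk G S u w fs × Unique fs
  walk⇒trail (nil u) = [] , nil u , []
  walk⇒trail {u} (cons i i∈ st W) with walk⇒trail W
  ... | fs , W′ , U with anyₗ? (i ≟_) fs
  ...   | no i∉    = i ∷ fs , cons i i∈ st W′ , ¬Any⇒All¬ fs i∉ ∷ U
  ...   | yes i∈fs with walk-split W′ U i∈fs
  ...     | p , q , gs , st′ , W″ , U′@(_ ∷ U″) with Step-unique st st′
  ...       | inj₁ (p≡u , _) = i ∷ gs , subst (λ z → Walk G S z _ (i ∷ gs)) p≡u (cons i i∈ st′ W″) , U′
  ...       | inj₂ (_ , q≡u) = gs , subst (λ z → Walk G S z _ gs) q≡u W″ , U″

walk-mono : ∀ {G S S′ u w es} → S ⊆ S′ → Walk G S u w es → Walk G S′ u w es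
walk-mono S⊆S′ (nil u)          = nil u
walk-mono S⊆S′ (cons i i∈ st W) = cons i (S⊆S′ i∈) st (walk-mono S⊆S′ W)

entrySet : ∀ {k m} → Vec (Fin k) m → Subset k
entrySet []      = ∅
entrySet (i ∷ v) = ⁅ i ⁆ ∪ entrySet v

∈-entrySet⁺ : ∀ {k m} (v : Vec (Fin k) m) x → lookup v x ∈ entrySet v
∈-entrySet⁺ (i ∷ v) zero    = x∈p∪q⁺ (inj₁ (x∈⁅x⁆ i))
∈-entrySet⁺ (i ∷ v) (suc x) = x∈p∪q⁺ (inj₂ (∈-entrySet⁺ v x))

∈-entrySet⁻ : ∀ {k m} (v : Vec (Fin k) m) {i} → i ∈ entrySet v → ∃ λ x → lookup v x ≡ i
∈-entrySet⁻ []      i∈ = ⊥-elim (∉⊥ i∈)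
∈-entrySet⁻ (j ∷ v) i∈ with x∈p∪q⁻ ⁅ j ⁆ (entrySet v) i∈
... | inj₁ i∈⁅j⁆ = zero , sym (x∈⁅y⁆⇒x≡y j i∈⁅j⁆)
... | inj₂ i∈v   = let x , e = ∈-entrySet⁻ v i∈v in suc x , e

-- Spanning trees as rooted choices of parent edges

module SpanningTrees {n Ne : ℕ} (endpoints : Fin Ne → Fin (suc n) × Fin (suc n)) where

  G : Graph
  G = graph (suc n) Ne endpoints

  incidentEdges : Fin (suc n) → List (Fin Ne)
  incidentEdges v = filter (incident? v ∘ endpoints) (allFin Ne)

  parentCandidates : Candidates n
  parentCandidates x = map (other (suc x) ∘ endpoints) (incidentEdges (suc x))

  parentMap : Vec (Fin Ne) n → Vec (Fin (suc n)) n
  parentMap = imap (λ x i → other (suc x) (endpoints i))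

  ValidParentEdges : Vec (Fin Ne) n → Set
  ValidParentEdges par = ∀ x → Incident (suc x) (endpoints (lookup par x))

  module ParentEdges (par : Vec (Fin Ne) n) (valid : ValidParentEdges par) where

    parent : Fin n → Fin (suc n)
    parent = lookup (parentMap par)

    parent-step : ∀ x → Step (endpoints (lookup par x)) (suc x) (parent x)
    parent-step x = subst (Step _ (suc x)) (sym (lookup∘tabulate _ x)) (Step-other _ (valid x))

    tree-edge : ∀ {i a b} → i ∈ entrySet par → Step (endpoints i) a b →
      ∃ λ x → lookup par x ≡ i × ((a ≡ suc x × b ≡ parent x) ⊎ (a ≡ parent x × b ≡ suc x))
    tree-edge i∈ st with ∈-entrySet⁻ par i∈
    ... | x , refl = x , refl , Step-unique (parent-step x) st

    module _ (rooted : Rooted (parentMap par)) where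

      private
        height = proj₁ rooted
        down   = proj₂ rooted
        T      = entrySet par

        up-step : ∀ {x a b} → a ≡ parent x → b ≡ suc x → height a < height b
        up-step {x} refl refl = down x

      walk-to-root : ∀ y → ∃ λ es → Walk G T y 0F es
      walk-to-root y = go (height y) y ≤-refl
        where
        go : ∀ k y → height y ≤ k → ∃ λ es → Walk G T y 0F es
        go _       0F      _   = [] , nil 0F
        go zero    (suc x) h≤k = ⊥-elim (n≮0 (<-≤-trans (down x) h≤k))
        go (suc k) (suc x) h≤k with go k (parent x) (s≤s⁻¹ (≤-trans (down x) h≤k))
        ... | es , W = lookup par x ∷ es , cons (lookup par x) (∈-entrySet⁺ par x) (parent-step x) W

      connected : Connected G T
      connected u w with walk-to-root u | walk-to-root w
      ... | es , Wu | _ , Ww with walk-reverse Ww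
      ...   | fs , Ww′ = es ++ fs , walk-++ Wu Ww′

      -- Leaving suc x other than by its parent edge, a trail of tree edges can only go
      -- from parents to children.
      descend : ∀ {a b es} x → a ≡ suc x → Walk G T a b es → lookup par x ∉ₗ es → Unique es →
        height a ≤ height b × ∃ λ y → b ≡ suc y × (y ≡ x ⊎ lookup par y ∈ₗ es)
      descend x a≡ (nil _) _ _ = ≤-refl , x , a≡ , inj₁ refl
      descend x a≡ (cons i i∈ st W) x∉ (i∉ ∷ U) with tree-edge i∈ st
      ... | x′ , refl , inj₁ (a≡′ , _) = ⊥-elim (x∉ (here (cong (lookup par) (suc-injective (trans (sym a≡) a≡′)))))
      ... | x′ , refl , inj₂ (a≡′ , b≡′) with descend x′ b≡′ W (All¬⇒¬Any i∉) U
      ...   | h≤ , y , b≡ , y≡⊎∈ = ≤-trans (<⇒≤ (up-step a≡′ b≡′)) h≤ , y , b≡ , inj₂ (later y≡⊎∈)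
        where later : y ≡ x′ ⊎ lookup par y ∈ₗ _ → lookup par y ∈ₗ lookup par x′ ∷ _
              later (inj₁ refl) = here refl
              later (inj₂ y∈)   = there y∈

      ascend : ∀ {c b es} y → b ≡ suc y → Walk G T c b es → lookup par y ∉ₗ es → Unique es → height b ≤ height c
      ascend y b≡ (nil _) _ _ = ≤-refl
      ascend y b≡ (cons i i∈ st W) y∉ (i∉ ∷ U) with tree-edge i∈ st
      ... | x , refl , inj₁ (c≡ , next≡) = ≤-trans (ascend y b≡ W (y∉ ∘ there) U) (<⇒≤ (up-step next≡ c≡))
      ... | x , refl , inj₂ (c≡ , next≡) with descend x next≡ W (All¬⇒¬Any i∉) U
      ...   | _ , y′ , b≡′ , inj₁ y′≡x =
              ⊥-elim (y∉ (here (cong (lookup par) (trans (suc-injective (trans (sym b≡) b≡′)) y′≡x))))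
      ...   | _ , y′ , b≡′ , inj₂ y′∈  =
              ⊥-elim (y∉ (there (subst (λ z → lookup par z ∈ₗ _) (suc-injective (trans (sym b≡′) b≡)) y′∈)))

      acyclic : ¬ HasCycle G T
      acyclic (u , i , es , i∉ ∷ U , cons _ i∈ st W) with tree-edge i∈ st
      ... | x , refl , inj₁ (u≡ , next≡) = <⇒≱ (up-step next≡ u≡) (ascend x u≡ W (All¬⇒¬Any i∉) U)
      ... | x , refl , inj₂ (u≡ , next≡) = <⇒≱ (up-step u≡ next≡) (proj₁ (descend x next≡ W (All¬⇒¬Any i∉) U))

  -- If par′ x ≠ par x, then par′ x = par u joins suc x and suc u for some u ≠ x; induction on
  -- the height of suc x gives par′ u = par u, making suc x and suc u each other's parent.
  entrySet-injective : ∀ {par par′} → ValidParentEdges par → ValidParentEdges par′ → Rooted (parentMap par′) →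
    entrySet par ≡ entrySet par′ → par ≡ par′
  entrySet-injective {par} {par′} valid valid′ (height , down) same =
    trans (sym (tabulate∘lookup par))
          (trans (tabulate-cong (λ x → agree (height (suc x)) x ≤-refl)) (tabulate∘lookup par′))
    where
    open ParentEdges par valid using (parent; parent-step)
    open ParentEdges par′ valid′ using () renaming (parent to parent′; parent-step to parent-step′)
    agree : ∀ k x → height (suc x) ≤ k → lookup par x ≡ lookup par′ x
    agree zero    x h≤k = ⊥-elim (n≮0 (<-≤-trans (down x) h≤k))
    agree (suc k) x h≤k with lookup par x ≟ lookup par′ x
    ... | yes same-x = same-x
    ... | no differ  = ⊥-elim (<-asym (subst (λ v → height v < height (suc u)) u↑ (down u))
                                      (subst (λ v → height v < height (suc x)) x↑ (down x)))
      where
      shared : ∃ λ u → lookup par u ≡ lookup par′ x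
      shared = ∈-entrySet⁻ par (subst (lookup par′ x ∈_) (sym same) (∈-entrySet⁺ par′ x))
      u = proj₁ shared
      u≢x : suc u ≢ suc x
      u≢x e = differ (trans (cong (lookup par) (sym (suc-injective e))) (proj₂ shared))
      x↑ : parent′ x ≡ suc u
      x↑ = proj₂ (Step-flip (subst (λ i → Step (endpoints i) (suc u) (parent u)) (proj₂ shared) (parent-step u))
                            (parent-step′ x) u≢x)
      agree-u : lookup par u ≡ lookup par′ u
      agree-u = agree k u (s≤s⁻¹ (≤-trans (subst (λ v → height v < height (suc x)) x↑ (down x)) h≤k))
      u↑ : parent′ u ≡ suc x
      u↑ = proj₂ (Step-flip (parent-step′ x)
                   (subst (λ i → Step (endpoints i) (suc u) (parent′ u)) (trans (sym agree-u) (proj₂ shared))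
                          (parent-step′ u))
                   (u≢x ∘ sym))

  -- Every vertex picks the first edge of a shortest walk to the root in T; the distance is a height.
  module FromSpanningTree {T : Subset Ne} (tree : IsSpanningTree G T) where

    ReachesRootIn : ℕ → Fin (suc n) → Set
    ReachesRootIn zero    v = v ≡ 0F
    ReachesRootIn (suc k) v = Σ (Fin Ne) λ i → i ∈ T × Σ (Fin (suc n)) λ w → Step (endpoints i) v w × ReachesRootIn k w

    reaches? : ∀ k v → Dec (ReachesRootIn k v)
    reaches? zero    v = v ≟ 0F
    reaches? (suc k) v = any? λ i → (i ∈? T) ×-dec any? λ w → Step? v w (endpoints i) ×-dec reaches? k w

    walk⇒reaches : ∀ {v es} → Walk G T v 0F es → ReachesRootIn (length es) v
    walk⇒reaches (nil _)                  = refl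
    walk⇒reaches (cons {w = w} i i∈ st W) = i , i∈ , w , st , walk⇒reaches W

    nearest : ∀ v → Σ ℕ λ k → ReachesRootIn k v × (∀ {j} → ReachesRootIn j v → k ≤ j)
    nearest v = leastWitness (λ k → reaches? k v) (walk⇒reaches (proj₂ (proj₁ tree v 0F)))

    distance : Fin (suc n) → ℕ
    distance v = proj₁ (nearest v)

    record EdgeTowardsRoot (x : Fin n) : Set where
      field
        edge    : Fin Ne
        edge∈T  : edge ∈ T
        target  : Fin (suc n)
        step    : Step (endpoints edge) (suc x) target
        closer  : distance target < distance (suc x)

    towardsRoot : ∀ x → EdgeTowardsRoot x
    towardsRoot x with nearest (suc x) in nearest≡
    ... | suc k , (i , i∈ , w , st , reach) , _ = record
      { edge = i ; edge∈T = i∈ ; target = w ; step = st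
      ; closer = subst (distance w <_) (sym (cong proj₁ nearest≡)) (s≤s (proj₂ (proj₂ (nearest w)) reach)) }

    open EdgeTowardsRoot

    par : Vec (Fin Ne) n
    par = tabulate (edge ∘ towardsRoot)

    par-towardsRoot : ∀ x → lookup par x ≡ edge (towardsRoot x)
    par-towardsRoot = lookup∘tabulate (edge ∘ towardsRoot)

    valid : ValidParentEdges par
    valid x rewrite par-towardsRoot x = Step⇒Incident _ (step (towardsRoot x))

    open ParentEdges par valid using (parent)

    parent-towardsRoot : ∀ x → parent x ≡ target (towardsRoot x)
    parent-towardsRoot x = trans (lookup∘tabulate _ x)
      (trans (cong (other (suc x) ∘ endpoints) (par-towardsRoot x)) (other-Step _ (step (towardsRoot x))))

    rooted : Rooted (parentMap par)
    rooted = distance , λ x → subst (λ w → distance w < distance (suc x)) (sym (parent-towardsRoot x))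
                                    (closer (towardsRoot x))

    entrySet⊆T : entrySet par ⊆ T
    entrySet⊆T i∈ with ∈-entrySet⁻ par i∈
    ... | x , refl rewrite par-towardsRoot x = edge∈T (towardsRoot x)

    -- An edge of T outside entrySet par would close a cycle with the tree path between its ends.
    T⊆entrySet : T ⊆ entrySet par
    T⊆entrySet {i} i∈T with i ∈? entrySet par
    ... | yes i∈ = i∈
    ... | no i∉ with ParentEdges.connected par valid rooted (proj₂ (endpoints i)) (proj₁ (endpoints i))
    ...   | _ , W with walk⇒trail W
    ...     | es , W′ , U = ⊥-elim (proj₂ tree (proj₁ (endpoints i) , i , es ,
                              ¬Any⇒All¬ es (i∉ ∘ walk-edges W′) ∷ U ,
                              cons i i∈T (inj₁ (refl , refl)) (walk-mono entrySet⊆T W′)))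

    entrySet≡T : entrySet par ≡ T
    entrySet≡T = ⊆-antisym entrySet⊆T T⊆entrySet

  rootedParentEdges : List (Vec (Fin Ne) n)
  rootedParentEdges = filter (rooted? ∘ parentMap) (choices (incidentEdges ∘ suc))

  ∈-rootedParentEdges⁻ : ∀ {par} → par ∈ₗ rootedParentEdges → ValidParentEdges par × Rooted (parentMap par)
  ∈-rootedParentEdges⁻ par∈ with ∈-filter⁻ (rooted? ∘ parentMap) par∈
  ... | par∈choices , rooted =
    (λ x → proj₂ (∈-filter⁻ (incident? (suc x) ∘ endpoints) {xs = allFin Ne}
                            (∈-choices⁻ (incidentEdges ∘ suc) par∈choices x))) ,
    rooted

  spanningTreeCount : SpanningTreeCount G (rootedCount parentCandidates)
  spanningTreeCount = map entrySet rootedParentEdges , unique , members , size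
    where
    unique : Unique (map entrySet rootedParentEdges)
    unique = Unique-map⁺ entrySet
      (λ par∈ par′∈ → entrySet-injective (proj₁ (∈-rootedParentEdges⁻ par∈))
                                         (proj₁ (∈-rootedParentEdges⁻ par′∈))
                                         (proj₂ (∈-rootedParentEdges⁻ par′∈)))
      (Unique.filter⁺ (rooted? ∘ parentMap) (choices-unique _ (λ x → Unique.filter⁺ _ (Unique.allFin⁺ Ne))))
    members : ∀ S → (S ∈ₗ map entrySet rootedParentEdges) ⇔ IsSpanningTree G S
    members S = mk⇔ to from
      where
      to : S ∈ₗ map entrySet rootedParentEdges → IsSpanningTree G S
      to S∈ with ∈-map⁻ entrySet S∈
      ... | par , par∈ , refl with ∈-rootedParentEdges⁻ par∈
      ...   | valid , rooted = ParentEdges.connected par valid rooted , ParentEdges.acyclic par valid rooted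
      from : IsSpanningTree G S → S ∈ₗ map entrySet rootedParentEdges
      from tree = subst (_∈ₗ map entrySet rootedParentEdges) entrySet≡T
        (∈-map⁺ entrySet (∈-filter⁺ (rooted? ∘ parentMap)
          (∈-choices⁺ (incidentEdges ∘ suc) {par}
            (λ x → ∈-filter⁺ (incident? (suc x) ∘ endpoints) (∈-allFin _) (valid x)))
          rooted))
        where open FromSpanningTree tree
    size : length (map entrySet rootedParentEdges) ≡ rootedCount parentCandidates
    size = begin
      length (map entrySet rootedParentEdges)
        ≡⟨ length-map entrySet rootedParentEdges ⟩
      length rootedParentEdges
        ≡⟨ sym (length-map parentMap rootedParentEdges) ⟩
      length (map parentMap rootedParentEdges)
        ≡⟨ cong length (sym (filter-map rooted? parentMap (choices (incidentEdges ∘ suc)))) ⟩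
      count rooted? (map parentMap (choices (incidentEdges ∘ suc)))
        ≡⟨ cong (count rooted?) (map-choices (λ x i → other (suc x) (endpoints i)) (incidentEdges ∘ suc)) ⟩
      rootedCount parentCandidates ∎
      where open ≡-Reasoning

-- The cone over a complete graph

module _ {k : ℕ} where

  liftEdge : Fin k × Fin k → Fin (suc k) × Fin (suc k)
  liftEdge = pmap suc suc

  spoke : Fin k → Fin (suc k) × Fin (suc k)
  spoke j = 0F , suc j

  Step-liftEdge⇔ : ∀ p {u w} → Step (liftEdge p) (suc u) (suc w) ⇔ Step p u w
  Step-liftEdge⇔ p = mk⇔ (Sum.map (Product.map suc-injective suc-injective) (Product.map suc-injective suc-injective))
                         (Sum.map (Product.map (cong suc) (cong suc)) (Product.map (cong suc) (cong suc)))

  ¬Step-liftEdge-to-root : ∀ p {u} → ¬ Step (liftEdge p) u 0F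
  ¬Step-liftEdge-to-root p (inj₁ (_ , ()))
  ¬Step-liftEdge-to-root p (inj₂ (() , _))

  ¬Step-liftEdge-from-root : ∀ p {w} → ¬ Step (liftEdge p) 0F w
  ¬Step-liftEdge-from-root p (inj₁ (() , _))
  ¬Step-liftEdge-from-root p (inj₂ (_ , ()))

  Step-spoke-to-root⇔ : ∀ j {u} → Step (spoke j) (suc u) 0F ⇔ j ≡ u
  Step-spoke-to-root⇔ j = mk⇔ (λ { (inj₁ (() , _)) ; (inj₂ (_ , e)) → suc-injective e })
                              (λ e → inj₂ (refl , cong suc e))

  Step-spoke-from-root⇔ : ∀ j {w} → Step (spoke j) 0F (suc w) ⇔ j ≡ w
  Step-spoke-from-root⇔ j = mk⇔ (λ { (inj₁ (_ , e)) → suc-injective e ; (inj₂ (() , _)) })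
                                (λ e → inj₁ (refl , cong suc e))

  ¬Step-spoke-inner : ∀ j {u w} → ¬ Step (spoke j) (suc u) (suc w)
  ¬Step-spoke-inner j (inj₁ (() , _))
  ¬Step-spoke-inner j (inj₂ (() , _))

count-KEdges : ∀ {n} {P : Fin (suc n) × Fin (suc n) → Set} (P? : Decidable P) →
  count P? (KEdges (suc n)) ≡ count (P? ∘ spoke) (allFin n) + count (P? ∘ liftEdge) (KEdges n)
count-KEdges {n} P? = trans (count-++ P? (map spoke (allFin n)) _)
                            (cong₂ _+_ (count-map P? spoke (allFin n)) (count-map P? liftEdge (KEdges n)))

count-Step-KEdges : ∀ {n} (x y : Fin n) → x ≢ y → count (Step? x y) (KEdges n) ≡ 1
count-Step-KEdges {suc n} 0F      0F      x≢y = ⊥-elim (x≢y refl)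
count-Step-KEdges {suc n} 0F      (suc y) x≢y = trans (count-KEdges (Step? 0F (suc y)))
  (cong₂ _+_ (count-allFin _ y (λ j → Step-spoke-from-root⇔ j))
             (count-none _ (All.universal (λ p → ¬Step-liftEdge-from-root p) (KEdges n))))
count-Step-KEdges {suc n} (suc x) 0F      x≢y = trans (count-KEdges (Step? (suc x) 0F))
  (cong₂ _+_ (count-allFin _ x (λ j → Step-spoke-to-root⇔ j))
             (count-none _ (All.universal (λ p → ¬Step-liftEdge-to-root p) (KEdges n))))
count-Step-KEdges {suc n} (suc x) (suc y) x≢y = trans (count-KEdges (Step? (suc x) (suc y)))
  (cong₂ _+_ (count-none _ (All.universal (λ j → ¬Step-spoke-inner j) (allFin n)))
             (trans (count-≐ _ (Step? x y) (λ p → Step-liftEdge⇔ p) (KEdges n))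
                    (count-Step-KEdges x y (x≢y ∘ cong suc))))

count-ConeEdges : ∀ m n {P : Fin (suc n) × Fin (suc n) → Set} (P? : Decidable P) →
  count P? (ConeEdges m n (KEdges n)) ≡ count (P? ∘ liftEdge) (KEdges n) + m * count (P? ∘ spoke) (allFin n)
count-ConeEdges m n P? = trans (count-++ P? (map liftEdge (KEdges n)) _)
  (cong₂ _+_ (count-map P? liftEdge (KEdges n)) (count-concatMap-replicate P? m spoke (allFin n)))

module _ (m n : ℕ) where

  private
    es = ConeEdges m n (KEdges n)

  open SpanningTrees (List.lookup es) using (parentCandidates)

  mult-parentCandidates : ∀ x b → mult (parentCandidates x) b ≡ count (Step? (suc x) b) es
  mult-parentCandidates x b = begin
    mult (parentCandidates x) b
      ≡⟨ mult-neighbours (List.lookup es) (suc x) b (allFin (length es)) ⟩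
    count (Step? (suc x) b ∘ List.lookup es) (allFin (length es))
      ≡⟨ sym (count-map (Step? (suc x) b) (List.lookup es) (allFin (length es))) ⟩
    count (Step? (suc x) b) (map (List.lookup es) (allFin (length es)))
      ≡⟨ cong (count (Step? (suc x) b)) (trans (map-tabulate id (List.lookup es)) (tabulate-lookup es)) ⟩
    count (Step? (suc x) b) es ∎
    where open ≡-Reasoning

  Weighted-cone : Weighted m (λ _ → 1) parentCandidates
  Weighted-cone = record { root-weight = root-weight ; other-weight = other-weight }
    where
    root-weight : ∀ x → mult (parentCandidates x) 0F ≡ m
    root-weight x = begin
      mult (parentCandidates x) 0F
        ≡⟨ mult-parentCandidates x 0F ⟩
      count (Step? (suc x) 0F) es
        ≡⟨ count-ConeEdges m n (Step? (suc x) 0F) ⟩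
      count (Step? (suc x) 0F ∘ liftEdge) (KEdges n) + m * count (Step? (suc x) 0F ∘ spoke) (allFin n)
        ≡⟨ cong₂ _+_ (count-none _ (All.universal (λ p → ¬Step-liftEdge-to-root p) (KEdges n)))
                     (cong (m *_) (count-allFin _ x (λ j → Step-spoke-to-root⇔ j))) ⟩
      m * 1
        ≡⟨ *-identityʳ m ⟩
      m ∎
      where open ≡-Reasoning
    other-weight : ∀ x y → y ≢ x → mult (parentCandidates x) (suc y) ≡ 1
    other-weight x y y≢x = begin
      mult (parentCandidates x) (suc y)
        ≡⟨ mult-parentCandidates x (suc y) ⟩
      count (Step? (suc x) (suc y)) es
        ≡⟨ count-ConeEdges m n (Step? (suc x) (suc y)) ⟩
      count (Step? (suc x) (suc y) ∘ liftEdge) (KEdges n) + m * count (Step? (suc x) (suc y) ∘ spoke) (allFin n)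
        ≡⟨ cong₂ _+_ (trans (count-≐ _ (Step? x y) (λ p → Step-liftEdge⇔ p) (KEdges n))
                            (count-Step-KEdges x y (y≢x ∘ sym)))
                     (cong (m *_) (count-none _ (All.universal (λ j → ¬Step-spoke-inner j) (allFin n)))) ⟩
      1 + m * 0
        ≡⟨ cong suc (*-zeroʳ m) ⟩
      1 ∎
      where open ≡-Reasoning

theorem2p1 : (m n : ℕ) → 1 ≤ m →
    Σ ℕ λ t → SpanningTreeCount (ConeK m n) t × t * (m + n) ≡ m * (m + n) ^ n
theorem2p1 m n _ = rootedCount parentCandidates , spanningTreeCount ,
  subst (λ W → rootedCount parentCandidates * (m + W) ≡ m * (m + W) ^ n) (∑-ones n)
        (rootedCount-weighted′ m (λ _ → 1) parentCandidates (Weighted-cone m n))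
  where open SpanningTrees (List.lookup (ConeEdges m n (KEdges n)))
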